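{- Let $n>0$ be an integer. Let $H_{2n+1,2n+3}$ be the graph on vertices $v_0,\dots,v_{2n+2}$ in which $v_0$ is adjacent to all other vertices and, for $1\le i<j\le 2n+2$, $v_i\sim v_j$ iff $j\ne i+n+1$ (so the induced subgraph on $\{v_1,\dots,v_{2n+2}\}$ is isomorphic to $H_{2n,2n+2}$ and $H_{2n+1,2n+3}\cong H_{2n,2n+2}+K_1$). Let $H^{\dagger}_{2n+1,2n+3}$ be obtained by deleting all edges among $v_1,\dots,v_{2n+2}$ and adding $2n$ new vertices $u_0,\dots,u_{2n-1}$, each adjacent to every one of $v_1,\dots,v_{2n+2}$. Then $H^{\dagger}_{2n+1,2n+3}$ is distance magic.
   Context: A distance magic labeling of a graph $G$ on $N$ vertices is a bijection $f:V(G)\to\{1,\dots,N\}$ such that $w_G(u)=\sum_{v\in N_G(u)}f(v)$ is the same constant for all vertices $u$; $G$ is distance magic if it has one. The description of $H_{2n+1,2n+3}$ given is the Harary graph construction for odd $m=2n+1$ and odd order $2n+3$. -}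

module Defs where

open import Data.Nat using (ℕ; zero; suc; _+_; _*_; _≡ᵇ_; _<ᵇ_)
open import Data.Bool using (Bool; true; false; not; _∧_; _∨_; if_then_else_)
open import Data.Fin using (Fin; toℕ)
open import Data.List using (List; map; allFin)
open import Data.Nat.ListAction using (sum)
open import Data.Product using (Σ; ∃; _,_)
open import Function.Definitions using (Bijective)
open import Relation.Binary.PropositionalEquality using (_≡_)

Graph : ℕ → Set
Graph N = Fin N → Fin N → Bool

-- Neighbourhood weight w_G(u) = Σ_{v ∈ N_G(u)} ℓ(v), where the label of v
-- is ℓ(v) = 1 + toℕ (f v) ∈ {1,…,N}.
weight : {N : ℕ} → Graph N → (Fin N → Fin N) → Fin N → ℕ
weight {N} G f u = sum (map (λ v → if G u v then suc (toℕ (f v)) else 0) (allFin N))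

IsDistanceMagic : {N : ℕ} → Graph N → Set
IsDistanceMagic {N} G =
  Σ (Fin N → Fin N) λ f → Bijective _≡_ _≡_ f × ∃ λ k → ∀ u → weight G f u ≡ k
  where open import Data.Product using (_×_)

hAdj : ℕ → ℕ → ℕ → Bool
hAdj n i j =
  not (i ≡ᵇ j) ∧
  ((i ≡ᵇ 0) ∨ (j ≡ᵇ 0) ∨ not ((j ≡ᵇ i + n + 1) ∨ (i ≡ᵇ j + n + 1)))

H : (n : ℕ) → Graph (2 * n + 3)
H n i j = hAdj n (toℕ i) (toℕ j)

-- H†_{2n+1,2n+3} on Fin (4n+3): index k < 2n+3 is v_k, index 2n+3+j is u_j
-- (0 ≤ j < 2n).
daggerAdj : ℕ → ℕ → ℕ → Bool
daggerAdj n i j with i <ᵇ 2 * n + 3 | j <ᵇ 2 * n + 3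
... | true  | true  = hAdj n i j ∧ ((i ≡ᵇ 0) ∨ (j ≡ᵇ 0))
... | true  | false = not (i ≡ᵇ 0)
... | false | true  = not (j ≡ᵇ 0)
... | false | false = false

Hdagger : (n : ℕ) → Graph (4 * n + 3)
Hdagger n i j = daggerAdj n (toℕ i) (toℕ j)

{-# OPTIONS --safe #-}
-- H† is the complete bipartite graph between V = {v₁, …, v_{2n+2}} and
-- W = {v₀, u₀, …, u_{2n-1}}: the weight of a vertex is the label sum of the opposite
-- side, so a labelling is distance magic as soon as both sides carry half of
-- 1 + ⋯ + (4n+3), namely (n+1)(4n+3). Shifting the indices cyclically by n - 1 gives V
-- the consecutive labels n+1, …, 3n+2, whose sum is exactly that.
module Submission where

open import Defs
open import Data.Nat using (ℕ; _<_)
open import Data.Nat using (zero; suc; _+_; _*_; _∸_; _≤_; _<ᵇ_; s≤s; z<s; s<s)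
open import Data.Nat.Properties
open import Data.Bool using (Bool; true; false; not; _xor_; if_then_else_; T)
open import Data.Bool.Properties using (∧-zeroʳ; T-≡)
open import Data.Fin using (Fin; toℕ; fromℕ<)
open import Data.Fin.Properties using (toℕ-fromℕ<; toℕ-injective; toℕ<n)
open import Data.List using (map; allFin; tabulate)
open import Data.List.Properties using (map-cong; map-tabulate)
open import Data.Nat.ListAction using (sum)
open import Data.Product using (_,_)
open import Function using (_∘_; Equivalence)
open import Function.Definitions using (Bijective)
open import Function.Consequences.Propositional
  using (inverseᵇ⇒bijective; strictlyInverseˡ⇒inverseˡ; strictlyInverseʳ⇒inverseʳ)
open import Relation.Binary.PropositionalEquality
open import Relation.Nullary using (yes; no; contradiction)
open import Data.Nat.Tactic.RingSolver using (solve-∀)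

<ᵇ-true : ∀ {a b} → a < b → (a <ᵇ b) ≡ true
<ᵇ-true a<b = Equivalence.to T-≡ (<⇒<ᵇ a<b)

<ᵇ-false : ∀ {a b} → b ≤ a → (a <ᵇ b) ≡ false
<ᵇ-false {a} {b} b≤a with a <ᵇ b in eq
... | false = refl
... | true  = contradiction (<ᵇ⇒< a b (subst T (sym eq) _)) (≤⇒≯ b≤a)

sumUpTo : ℕ → (ℕ → ℕ) → ℕ
sumUpTo zero    h = 0
sumUpTo (suc n) h = h 0 + sumUpTo n (h ∘ suc)

syntax sumUpTo n (λ k → e) = ∑[ k < n ] e

sum-tabulate-toℕ : ∀ n (h : ℕ → ℕ) → sum (tabulate {n = n} (h ∘ toℕ)) ≡ ∑[ k < n ] h k
sum-tabulate-toℕ zero    h = refl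
sum-tabulate-toℕ (suc n) h = cong (h 0 +_) (sum-tabulate-toℕ n (h ∘ suc))

sumUpTo-+ : ∀ a b (h : ℕ → ℕ) → ∑[ k < a + b ] h k ≡ ∑[ k < a ] h k + ∑[ k < b ] h (a + k)
sumUpTo-+ zero    b h = refl
sumUpTo-+ (suc a) b h =
  trans (cong (h 0 +_) (sumUpTo-+ a b (h ∘ suc))) (sym (+-assoc (h 0) _ _))

sumUpTo-cong : ∀ n {h g : ℕ → ℕ} → (∀ {k} → k < n → h k ≡ g k) →
               ∑[ k < n ] h k ≡ ∑[ k < n ] g k
sumUpTo-cong zero    h≡g = refl
sumUpTo-cong (suc n) h≡g = cong₂ _+_ (h≡g z<s) (sumUpTo-cong n (h≡g ∘ s<s))

sumUpTo-if-true : ∀ n (p : ℕ → Bool) (h : ℕ → ℕ) → (∀ {k} → k < n → p k ≡ true) →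
                  ∑[ k < n ] (if p k then h k else 0) ≡ ∑[ k < n ] h k
sumUpTo-if-true n p h p≡true = sumUpTo-cong n (λ k<n → cong (if_then _ else 0) (p≡true k<n))

sumUpTo-if-false : ∀ n (p : ℕ → Bool) (h : ℕ → ℕ) → (∀ {k} → k < n → p k ≡ false) →
                   ∑[ k < n ] (if p k then h k else 0) ≡ 0
sumUpTo-if-false zero    p h p≡false = refl
sumUpTo-if-false (suc n) p h p≡false =
  cong₂ _+_ (cong (if_then _ else 0) (p≡false z<s))
            (sumUpTo-if-false n (p ∘ suc) (h ∘ suc) (p≡false ∘ s<s))

sumUpTo-consecutive : ∀ b c → 2 * ∑[ k < b ] suc (c + k) ≡ b * (2 * c + b + 1)
sumUpTo-consecutive zero    c = refl
sumUpTo-consecutive (suc b) c = begin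
  2 * (suc (c + 0) + ∑[ k < b ] suc (c + suc k))
    ≡⟨ cong (λ t → 2 * (suc (c + 0) + t)) (sumUpTo-cong b (λ {k} _ → cong suc (+-suc c k))) ⟩
  2 * (suc (c + 0) + ∑[ k < b ] suc (suc c + k))
    ≡⟨ *-distribˡ-+ 2 (suc (c + 0)) _ ⟩
  2 * suc (c + 0) + 2 * ∑[ k < b ] suc (suc c + k)
    ≡⟨ cong (2 * suc (c + 0) +_) (sumUpTo-consecutive b (suc c)) ⟩
  2 * suc (c + 0) + b * (2 * suc c + b + 1)
    ≡⟨ step b c ⟩
  suc b * (2 * c + suc b + 1) ∎
  where
  open ≡-Reasoning
  step : ∀ b c → 2 * suc (c + 0) + b * (2 * suc c + b + 1) ≡ suc b * (2 * c + suc b + 1)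
  step = solve-∀

-- Adding r modulo r + c, on the range k < r + c.
rotate : ℕ → ℕ → ℕ → ℕ
rotate r c k = if k <ᵇ c then k + r else k ∸ c

rotate-below : ∀ r c {k} → k < c → rotate r c k ≡ k + r
rotate-below r c {k} k<c = cong (if_then k + r else k ∸ c) (<ᵇ-true k<c)

rotate-above : ∀ r c {k} → c ≤ k → rotate r c k ≡ k ∸ c
rotate-above r c {k} c≤k = cong (if_then k + r else k ∸ c) (<ᵇ-false c≤k)

rotate-< : ∀ r c {k} → k < r + c → rotate r c k < r + c
rotate-< r c {k} k<r+c with k <? c
... | yes k<c = subst (rotate r c k <_) (+-comm c r)
                  (subst (_< c + r) (sym (rotate-below r c k<c)) (+-monoˡ-< r k<c))
... | no  k≮c = subst (_< r + c) (sym (rotate-above r c (≮⇒≥ k≮c)))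
                  (≤-<-trans (m∸n≤m k c) k<r+c)

rotate-inverse : ∀ r c {k} → k < r + c → rotate c r (rotate r c k) ≡ k
rotate-inverse r c {k} k<r+c with k <? c
... | yes k<c = begin
  rotate c r (rotate r c k) ≡⟨ cong (rotate c r) (rotate-below r c k<c) ⟩
  rotate c r (k + r)        ≡⟨ rotate-above c r (m≤n+m r k) ⟩
  k + r ∸ r                 ≡⟨ m+n∸n≡m k r ⟩
  k                         ∎
  where open ≡-Reasoning
... | no  k≮c = begin
  rotate c r (rotate r c k) ≡⟨ cong (rotate c r) (rotate-above r c c≤k) ⟩
  rotate c r (k ∸ c)        ≡⟨ rotate-below c r k∸c<r ⟩
  k ∸ c + c                 ≡⟨ m∸n+n≡m c≤k ⟩
  k                         ∎
  where
  open ≡-Reasoning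
  c≤k = ≮⇒≥ k≮c
  k∸c<r : k ∸ c < r
  k∸c<r = subst (k ∸ c <_) (m+n∸n≡m r c) (∸-monoˡ-< k<r+c c≤k)

rotateFin : ∀ {N} r c → r + c ≡ N → Fin N → Fin N
rotateFin r c r+c≡N v =
  fromℕ< (subst (rotate r c (toℕ v) <_) r+c≡N
                (rotate-< r c (subst (toℕ v <_) (sym r+c≡N) (toℕ<n v))))

toℕ-rotateFin : ∀ {N} r c (r+c≡N : r + c ≡ N) v →
                toℕ (rotateFin r c r+c≡N v) ≡ rotate r c (toℕ v)
toℕ-rotateFin r c r+c≡N v = toℕ-fromℕ< _

rotateFin-inverse : ∀ {N} r c (r+c≡N : r + c ≡ N) (c+r≡N : c + r ≡ N) v →
                    rotateFin c r c+r≡N (rotateFin r c r+c≡N v) ≡ v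
rotateFin-inverse r c r+c≡N c+r≡N v = toℕ-injective (begin
  toℕ (rotateFin c r c+r≡N (rotateFin r c r+c≡N v))
    ≡⟨ toℕ-rotateFin c r c+r≡N (rotateFin r c r+c≡N v) ⟩
  rotate c r (toℕ (rotateFin r c r+c≡N v))
    ≡⟨ cong (rotate c r) (toℕ-rotateFin r c r+c≡N v) ⟩
  rotate c r (rotate r c (toℕ v))
    ≡⟨ rotate-inverse r c (subst (toℕ v <_) (sym r+c≡N) (toℕ<n v)) ⟩
  toℕ v ∎)
  where open ≡-Reasoning

rotateFin-bijective : ∀ {N} r c (r+c≡N : r + c ≡ N) → Bijective _≡_ _≡_ (rotateFin r c r+c≡N)
rotateFin-bijective r c r+c≡N = inverseᵇ⇒bijective
  { f⁻¹ = rotateFin c r c+r≡N }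
  ( strictlyInverseˡ⇒inverseˡ (rotateFin r c r+c≡N) (rotateFin-inverse c r c+r≡N r+c≡N)
  , strictlyInverseʳ⇒inverseʳ (rotateFin r c r+c≡N) (rotateFin-inverse r c r+c≡N c+r≡N))
  where c+r≡N = trans (+-comm c r) r+c≡N

isInner : ℕ → ℕ → Bool
isInner n zero    = false
isInner n (suc i) = suc i <ᵇ 2 * n + 3

0<ᵇ2n+3 : ∀ n → (0 <ᵇ 2 * n + 3) ≡ true
0<ᵇ2n+3 n = <ᵇ-true (<-≤-trans z<s (m≤n+m 3 (2 * n)))

daggerAdj-bipartite : ∀ n i j → daggerAdj n i j ≡ isInner n i xor isInner n j
daggerAdj-bipartite n zero    zero    rewrite 0<ᵇ2n+3 n = refl
daggerAdj-bipartite n zero    (suc j) rewrite 0<ᵇ2n+3 n with suc j <ᵇ 2 * n + 3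
... | true  = refl
... | false = refl
daggerAdj-bipartite n (suc i) zero    rewrite 0<ᵇ2n+3 n with suc i <ᵇ 2 * n + 3
... | true  = refl
... | false = refl
daggerAdj-bipartite n (suc i) (suc j) with suc i <ᵇ 2 * n + 3 | suc j <ᵇ 2 * n + 3
... | true  | true  = ∧-zeroʳ _
... | true  | false = refl
... | false | true  = refl
... | false | false = refl

isInner-inner : ∀ n {i} → i < 2 * n + 2 → isInner n (suc i) ≡ true
isInner-inner n {i} i< = <ᵇ-true (subst (suc i <_) (sym (+-suc (2 * n) 2)) (s<s i<))

isInner-outer : ∀ n {i} → 2 * n + 2 ≤ i → isInner n (suc i) ≡ false
isInner-outer n {i} ≤i = <ᵇ-false (subst (_≤ suc i) (sym (+-suc (2 * n) 2)) (s≤s ≤i))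

weight-as-sumUpTo : ∀ {N} (G : Graph N) (adj : ℕ → ℕ → Bool) (f : Fin N → Fin N)
                    (label : ℕ → ℕ) →
                    (∀ u v → G u v ≡ adj (toℕ u) (toℕ v)) →
                    (∀ v → suc (toℕ (f v)) ≡ label (toℕ v)) →
                    ∀ u → weight G f u ≡ ∑[ k < N ] (if adj (toℕ u) k then label k else 0)
weight-as-sumUpTo {N} G adj f label G≡adj f≡label u = begin
  sum (map (λ v → if G u v then suc (toℕ (f v)) else 0) (allFin N))
    ≡⟨ cong sum (map-cong (λ v → cong₂ (if_then_else 0) (G≡adj u v) (f≡label v)) (allFin N)) ⟩
  sum (map (ψ ∘ toℕ) (allFin N))  ≡⟨ cong sum (map-tabulate {n = N} (λ v → v) (ψ ∘ toℕ)) ⟩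
  sum (tabulate {n = N} (ψ ∘ toℕ)) ≡⟨ sum-tabulate-toℕ N ψ ⟩
  ∑[ k < N ] ψ k                   ∎
  where
  open ≡-Reasoning
  ψ : ℕ → ℕ
  ψ k = if adj (toℕ u) k then label k else 0

-- Here n = m + 1; the index of v_i is i and that of u_k is outer k.
module _ (m : ℕ) where

  label : ℕ → ℕ
  label k = suc (rotate m (3 * m + 7) k)

  outer : ℕ → ℕ
  outer k = suc (2 * suc m + 2 + k)

  label-centre : label 0 ≡ suc m
  label-centre = cong suc (rotate-below m (3 * m + 7) (<-≤-trans z<s (m≤n+m 7 (3 * m))))

  label-inner : ∀ {i} → i < 2 * suc m + 2 → label (suc i) ≡ suc (suc m + i)
  label-inner {i} i< = cong suc (trans (rotate-below m (3 * m + 7) (<-≤-trans (s<s i<) (bound m)))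
                                       (trans (+-comm (suc i) m) (+-suc m i)))
    where
    bound : ∀ m → suc (2 * suc m + 2) ≤ 3 * m + 7
    bound m = subst (suc (2 * suc m + 2) ≤_) (eq m) (m≤m+n _ (m + 2))
      where eq : ∀ m → suc (2 * suc m + 2) + (m + 2) ≡ 3 * m + 7
            eq = solve-∀

  label-outer-below : ∀ {k} → k < suc m + 1 → label (outer k) ≡ suc (3 * m + 5 + k)
  label-outer-below {k} k< =
    cong suc (trans (rotate-below m (3 * m + 7)
                                  (subst₂ _≤_ (eq₁ m k) (eq₂ m) (+-monoʳ-≤ (2 * m + 5) k<)))
                    (eq₃ m k))
    where
    eq₁ : ∀ m k → 2 * m + 5 + suc k ≡ suc (suc (2 * suc m + 2 + k))
    eq₁ = solve-∀
    eq₂ : ∀ m → 2 * m + 5 + (suc m + 1) ≡ 3 * m + 7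
    eq₂ = solve-∀
    eq₃ : ∀ m k → suc (2 * suc m + 2 + k) + m ≡ 3 * m + 5 + k
    eq₃ = solve-∀

  label-outer-above : ∀ k → label (outer (suc m + 1 + k)) ≡ suc k
  label-outer-above k = cong suc (begin
    rotate m (3 * m + 7) (outer (suc m + 1 + k)) ≡⟨ cong (rotate m (3 * m + 7)) (eq m k) ⟩
    rotate m (3 * m + 7) (k + (3 * m + 7))       ≡⟨ rotate-above m (3 * m + 7) (m≤n+m (3 * m + 7) k) ⟩
    k + (3 * m + 7) ∸ (3 * m + 7)                ≡⟨ m+n∸n≡m k (3 * m + 7) ⟩
    k                                             ∎)
    where
    open ≡-Reasoning
    eq : ∀ m k → suc (2 * suc m + 2 + (suc m + 1 + k)) ≡ k + (3 * m + 7)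
    eq = solve-∀

  sumUpTo-layout : ∀ h → ∑[ k < 4 * suc m + 3 ] h k ≡
                   h 0 + (∑[ k < 2 * suc m + 2 ] h (suc k) +
                          (∑[ k < suc m + 1 ] h (outer k) + ∑[ k < m ] h (outer (suc m + 1 + k))))
  sumUpTo-layout h = begin
    ∑[ k < 4 * suc m + 3 ] h k
      ≡⟨ cong (λ N → ∑[ k < N ] h k) (size m) ⟩
    h 0 + ∑[ k < 2 * suc m + 2 + (suc m + 1 + m) ] h (suc k)
      ≡⟨ cong (h 0 +_) (sumUpTo-+ (2 * suc m + 2) _ (h ∘ suc)) ⟩
    h 0 + (∑[ k < 2 * suc m + 2 ] h (suc k) + ∑[ k < suc m + 1 + m ] h (outer k))
      ≡⟨ cong (λ t → h 0 + (∑[ k < 2 * suc m + 2 ] h (suc k) + t))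
              (sumUpTo-+ (suc m + 1) m (h ∘ outer)) ⟩
    h 0 + (∑[ k < 2 * suc m + 2 ] h (suc k) +
           (∑[ k < suc m + 1 ] h (outer k) + ∑[ k < m ] h (outer (suc m + 1 + k)))) ∎
    where
    open ≡-Reasoning
    size : ∀ m → 4 * suc m + 3 ≡ suc (2 * suc m + 2 + (suc m + 1 + m))
    size = solve-∀

  inside : ℕ → Bool
  inside = isInner (suc m)

  labelOn : (ℕ → Bool) → ℕ → ℕ
  labelOn p k = if p k then label k else 0

  inside-outer : ∀ k → inside (outer k) ≡ false
  inside-outer k = isInner-outer (suc m) (m≤m+n _ k)

  inside-label-sum : ∑[ k < 4 * suc m + 3 ] labelOn inside k ≡ (m + 2) * (4 * m + 7)
  inside-label-sum = begin
    ∑[ k < 4 * suc m + 3 ] labelOn inside k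
      ≡⟨ sumUpTo-layout (labelOn inside) ⟩
    0 + (∑[ k < 2 * suc m + 2 ] labelOn inside (suc k) +
         (∑[ k < suc m + 1 ] labelOn inside (outer k) + ∑[ k < m ] labelOn inside (outer (suc m + 1 + k))))
      ≡⟨ cong₂ _+_ (sumUpTo-if-true (2 * suc m + 2) (inside ∘ suc) (label ∘ suc)
                                    (isInner-inner (suc m)))
                   (cong₂ _+_ (sumUpTo-if-false (suc m + 1) (inside ∘ outer) (label ∘ outer)
                                                (λ {k} _ → inside-outer k))
                              (sumUpTo-if-false m (inside ∘ outer ∘ (suc m + 1 +_))
                                                  (label ∘ outer ∘ (suc m + 1 +_))
                                                  (λ {k} _ → inside-outer (suc m + 1 + k)))) ⟩
    ∑[ k < 2 * suc m + 2 ] label (suc k) + (0 + 0)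
      ≡⟨ +-identityʳ _ ⟩
    ∑[ k < 2 * suc m + 2 ] label (suc k)
      ≡⟨ sumUpTo-cong (2 * suc m + 2) {h = label ∘ suc} label-inner ⟩
    ∑[ k < 2 * suc m + 2 ] suc (suc m + k)
      ≡⟨ *-cancelˡ-≡ _ _ 2 (trans (sumUpTo-consecutive (2 * suc m + 2) (suc m)) (eq m)) ⟩
    (m + 2) * (4 * m + 7) ∎
    where
    open ≡-Reasoning
    eq : ∀ m → (2 * suc m + 2) * (2 * suc m + (2 * suc m + 2) + 1) ≡ 2 * ((m + 2) * (4 * m + 7))
    eq = solve-∀

  outside-label-sum : ∑[ k < 4 * suc m + 3 ] labelOn (not ∘ inside) k ≡ (m + 2) * (4 * m + 7)
  outside-label-sum = begin
    ∑[ k < 4 * suc m + 3 ] labelOn (not ∘ inside) k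
      ≡⟨ sumUpTo-layout (labelOn (not ∘ inside)) ⟩
    label 0 + (∑[ k < 2 * suc m + 2 ] labelOn (not ∘ inside) (suc k) +
               (∑[ k < suc m + 1 ] labelOn (not ∘ inside) (outer k) +
                ∑[ k < m ] labelOn (not ∘ inside) (outer (suc m + 1 + k))))
      ≡⟨ cong₂ _+_ label-centre
           (cong₂ _+_ (sumUpTo-if-false (2 * suc m + 2) (not ∘ inside ∘ suc) (label ∘ suc)
                                        (cong not ∘ isInner-inner (suc m)))
                      (cong₂ _+_ (sumUpTo-if-true (suc m + 1) (not ∘ inside ∘ outer) (label ∘ outer)
                                                  (λ {k} _ → cong not (inside-outer k)))
                                 (sumUpTo-if-true m (not ∘ inside ∘ outer ∘ (suc m + 1 +_))
                                                    (label ∘ outer ∘ (suc m + 1 +_))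
                                                    (λ {k} _ → cong not (inside-outer (suc m + 1 + k)))))) ⟩
    suc m + (0 + (∑[ k < suc m + 1 ] label (outer k) + ∑[ k < m ] label (outer (suc m + 1 + k))))
      ≡⟨ cong (suc m +_) (cong₂ _+_ (sumUpTo-cong (suc m + 1) {h = label ∘ outer} label-outer-below)
                                     (sumUpTo-cong m {h = label ∘ outer ∘ (suc m + 1 +_)}
                                                     (λ {k} _ → label-outer-above k))) ⟩
    suc m + (∑[ k < suc m + 1 ] suc (3 * m + 5 + k) + ∑[ k < m ] suc (0 + k))
      ≡⟨ *-cancelˡ-≡ _ _ 2 (begin
           2 * (suc m + (∑[ k < suc m + 1 ] suc (3 * m + 5 + k) + ∑[ k < m ] suc (0 + k)))
             ≡⟨ distrib m (∑[ k < suc m + 1 ] suc (3 * m + 5 + k)) (∑[ k < m ] suc (0 + k)) ⟩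
           2 * suc m + 2 * ∑[ k < suc m + 1 ] suc (3 * m + 5 + k) + 2 * ∑[ k < m ] suc (0 + k)
             ≡⟨ cong₂ (λ x y → 2 * suc m + x + y) (sumUpTo-consecutive (suc m + 1) (3 * m + 5))
                                                  (sumUpTo-consecutive m 0) ⟩
           2 * suc m + (suc m + 1) * (2 * (3 * m + 5) + (suc m + 1) + 1) + m * (2 * 0 + m + 1)
             ≡⟨ eq m ⟩
           2 * ((m + 2) * (4 * m + 7)) ∎) ⟩
    (m + 2) * (4 * m + 7) ∎
    where
    open ≡-Reasoning
    distrib : ∀ m x y → 2 * (suc m + (x + y)) ≡ 2 * suc m + 2 * x + 2 * y
    distrib = solve-∀
    eq : ∀ m → 2 * suc m + (suc m + 1) * (2 * (3 * m + 5) + (suc m + 1) + 1) + m * (2 * 0 + m + 1)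
               ≡ 2 * ((m + 2) * (4 * m + 7))
    eq = solve-∀

  opposite-label-sum : ∀ b →
                       ∑[ k < 4 * suc m + 3 ] labelOn (λ k → b xor inside k) k ≡ (m + 2) * (4 * m + 7)
  opposite-label-sum false = inside-label-sum
  opposite-label-sum true  = outside-label-sum

mainTheorem4 : (n : ℕ) → 0 < n → IsDistanceMagic (Hdagger n)
mainTheorem4 zero    ()
mainTheorem4 (suc m) _ = f , rotateFin-bijective m (3 * m + 7) (size m) , (m + 2) * (4 * m + 7) , magic
  where
  size : ∀ m → m + (3 * m + 7) ≡ 4 * suc m + 3
  size = solve-∀
  f : Fin (4 * suc m + 3) → Fin (4 * suc m + 3)
  f = rotateFin m (3 * m + 7) (size m)
  magic : ∀ u → weight (Hdagger (suc m)) f u ≡ (m + 2) * (4 * m + 7)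
  magic u = trans
    (weight-as-sumUpTo (Hdagger (suc m)) (λ i j → isInner (suc m) i xor isInner (suc m) j) f (label m)
       (λ v w → daggerAdj-bipartite (suc m) (toℕ v) (toℕ w))
       (λ v → cong suc (toℕ-rotateFin m (3 * m + 7) (size m) v))
       u)
    (opposite-label-sum m (isInner (suc m) (toℕ u)))
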